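{- Let $\pi(X_1,\dots,X_n)=\exists Y_1\dots\exists Y_k(B_1\wedge\dots\wedge B_m)$ be an existential $\mathcal C$-constraint with free variables $X_1,\dots,X_n$ (the $B_j$ atomic $\mathcal C$-constraints), and let $\mathcal P$ be a $\mathrm{CLP}(\mathcal C)$-program containing the clause $p(X_1,\dots,X_n)\gets B_1,\dots,B_m$, where $p\in DP^n$ does not occur at the head of any other clause of $\mathcal P$. Then for every $n$-tuple $t_1,\dots,t_n$ of $\mathcal C$-terms and every finite satisfiable $\Pi$: (1) if $\mathcal P\vdash_{\mathrm{CHL}(\mathcal C)}p(t_1,\dots,t_n)\Leftarrow\Pi$ then $\Pi\models_{\mathcal C}\pi(t_1,\dots,t_n)$, where $\pi(t_1,\dots,t_n)$ is the result of applying $\{X_i\mapsto t_i\}$ to $\pi$; (2) if $t_1,\dots,t_n$ are ground, then conversely $\Pi\models_{\mathcal C}\pi(t_1,\dots,t_n)$ implies $\mathcal P\vdash_{\mathrm{CHL}(\mathcal C)}p(t_1,\dots,t_n)\Leftarrow\Pi$.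
   Context: Fix ranked disjoint sets $DC$ of data constructors, $DP$ of defined predicate symbols and $PP$ of primitive predicate symbols. A constraint domain $\mathcal C$ has basic values $B_{\mathcal C}$, a carrier $C_{\mathcal C}$ of ground terms built from basic values and data constructors, and interprets primitive predicates as relations on $C_{\mathcal C}$. Atoms are defined atoms $p(t_1,\dots,t_n)$ ($p\in DP^n$), primitive atoms $\kappa=r(t_1,\dots,t_n)$ ($r\in PP^n$) and equations $t==s$; the latter two are atomic $\mathcal C$-constraints. A valuation is a ground substitution into $C_{\mathcal C}$; $\mathrm{Sol}_{\mathcal C}(\Pi)$ is the set of valuations $\eta$ with $\Pi\eta$ true in $\mathcal C$ (equations true iff both sides identical; existential constraints with the usual meaning); $\Pi$ satisfiable iff $\mathrm{Sol}_{\mathcal C}(\Pi)\neq\emptyset$; $\Pi\models_{\mathcal C}\pi$ iff $\mathrm{Sol}_{\mathcal C}(\Pi)\subseteq\mathrm{Sol}_{\mathcal C}(\pi)$. A $\mathrm{CLP}(\mathcal C)$-program is a set of clauses $p(t_1,\dots,t_n)\gets B_1,\dots,B_m$ ($B_j$ atoms). The calculus $\mathrm{CHL}(\mathcal C)$ derives constrained atoms $A\Leftarrow\Pi$ ($\Pi$ a finite set of constraints) by: (DA) from $(t'_i==t_i\theta)\Leftarrow\Pi$ ($1\le i\le n$) and $B_j\theta\Leftarrow\Pi$ ($1\le j\le m$) infer $p(t'_1,\dots,t'_n)\Leftarrow\Pi$, if $p(t_1,\dots,t_n)\gets B_1,\dots,B_m\in\mathcal P$ and $\theta$ is a substitution;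 (EA) infer $(t==s)\Leftarrow\Pi$ if $\Pi\models_{\mathcal C}t==s$; (PA) infer $\kappa\Leftarrow\Pi$ if $\Pi\models_{\mathcal C}\kappa$. $\mathcal P\vdash_{\mathrm{CHL}(\mathcal C)}\varphi$ means $\varphi$ is derivable. -}

module Defs where

open import Data.Nat using (ℕ; suc; _+_; _⊔_; _≡ᵇ_)
open import Data.Nat.Properties using (_≟_)
open import Data.Bool using (if_then_else_)
open import Data.Maybe using (Maybe; just; nothing)
open import Data.List using (List; []; _∷_; map; foldr; filter; concatMap; length; upTo)
open import Data.List.Relation.Unary.All using (All)
open import Data.List.Membership.Propositional using (_∈_; _∉_)
open import Data.List.Membership.DecPropositional _≟_ using (_∈?_)
open import Data.Vec using (Vec; []; _∷_; lookup)
open import Data.Fin using (Fin)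
open import Data.Product using (Σ; ∃; _×_; _,_)
open import Relation.Nullary using (¬?)
open import Relation.Binary.PropositionalEquality using (_≡_)

-- Ranked disjoint sets DC (data constructors), DP (defined predicates),
-- PP (primitive predicates): a set of symbols for each arity.
record Signature : Set₁ where
  field
    DC DP PP : ℕ → Set

data GTerm (DC : ℕ → Set) (BV : Set) : Set where
  gval : BV → GTerm DC BV
  gcon : ∀ {n} → DC n → Vec (GTerm DC BV) n → GTerm DC BV

record Domain (Sig : Signature) : Set₁ where
  open Signature Sig
  field
    BV     : Set
    interp : ∀ {n} → PP n → Vec (GTerm DC BV) n → Set

module CLP (Sig : Signature) (𝒞 : Domain Sig) where
  open Signature Sig public
  open Domain 𝒞 public

  Var : Set
  Var = ℕ

  Val : Set
  Val = GTerm DC BV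

  data Term : Set where
    var : Var → Term
    val : BV → Term
    con : ∀ {n} → DC n → Vec Term n → Term

  Valuation : Set
  Valuation = Var → Val

  Subst : Set
  Subst = Var → Term

  mutual
    eval : Valuation → Term → Val
    eval η (var x)    = η x
    eval η (val b)    = gval b
    eval η (con c ts) = gcon c (evals η ts)

    evals : ∀ {n} → Valuation → Vec Term n → Vec Val n
    evals η []       = []
    evals η (t ∷ ts) = eval η t ∷ evals η ts

  mutual
    sub : Subst → Term → Term
    sub θ (var x)    = θ x
    sub θ (val b)    = val b
    sub θ (con c ts) = con c (subs θ ts)

    subs : ∀ {n} → Subst → Vec Term n → Vec Term n
    subs θ []       = []
    subs θ (t ∷ ts) = sub θ t ∷ subs θ ts

  mutual
    vars : Term → List Var
    vars (var x)    = x ∷ []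
    vars (val b)    = []
    vars (con c ts) = varss ts

    varss : ∀ {n} → Vec Term n → List Var
    varss []       = []
    varss (t ∷ ts) = vars t Data.List.++ varss ts

  Ground : Term → Set
  Ground t = vars t ≡ []

  maxVar : Term → ℕ
  maxVar t = foldr _⊔_ 0 (vars t)

  data AConstr : Set where
    prim : ∀ {n} → PP n → Vec Term n → AConstr
    _==_ : Term → Term → AConstr

  data Atom : Set where
    def    : ∀ {n} → DP n → Vec Term n → Atom
    constr : AConstr → Atom

  varsA : AConstr → List Var
  varsA (prim r ts) = varss ts
  varsA (t == s)    = vars t Data.List.++ vars s

  subA : Subst → AConstr → AConstr
  subA θ (prim r ts) = prim r (subs θ ts)
  subA θ (t == s)    = sub θ t == sub θ s

  subAtom : Subst → Atom → Atom
  subAtom θ (def p ts)   = def p (subs θ ts)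
  subAtom θ (constr κ)   = constr (subA θ κ)

  holdsA : Valuation → AConstr → Set
  holdsA η (prim r ts) = interp r (evals η ts)
  holdsA η (t == s)    = eval η t ≡ eval η s

  -- C-constraints: existential constraints  ∃ Y1 … ∃ Yk (B1 ∧ … ∧ Bm)
  -- (an atomic constraint κ is  exC [] (κ ∷ []) ).
  data Constraint : Set where
    exC : List Var → List AConstr → Constraint

  atomic : AConstr → Constraint
  atomic κ = exC [] (κ ∷ [])

  Sol : Valuation → Constraint → Set
  Sol η (exC Ys Bs) =
    Σ Valuation λ ρ → (∀ x → x ∉ Ys → ρ x ≡ η x) × All (holdsA ρ) Bs

  Sols : Valuation → List Constraint → Set
  Sols η Π = All (Sol η) Π

  Satisfiable : List Constraint → Set
  Satisfiable Π = ∃ λ η → Sols η Π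

  _⊨_ : List Constraint → Constraint → Set
  Π ⊨ c = ∀ η → Sols η Π → Sol η c

  indexOf : Var → List Var → Maybe ℕ
  indexOf y []       = nothing
  indexOf y (z ∷ zs) with y ≟ z
  ... | Relation.Nullary.yes _ = just 0
  ... | Relation.Nullary.no  _ with indexOf y zs
  ...   | just i  = just (suc i)
  ...   | nothing = nothing

  -- capture-avoiding application of a substitution to an existential constraint:
  -- bound variables are renamed to fresh ones N, N+1, … where N exceeds every
  -- variable occurring in θ x for x free in the constraint.
  subC : Subst → Constraint → Constraint
  subC θ (exC Ys Bs) = exC (map (N +_) (upTo (length Ys))) (map (subA σ) Bs)
    where
    free : List Var
    free = filter (λ x → ¬? (x ∈? Ys)) (concatMap varsA Bs)
    N : ℕ
    N = suc (foldr (λ x m → maxVar (θ x) ⊔ m) 0 free)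
    σ : Subst
    σ y with indexOf y Ys
    ... | just i  = var (N + i)
    ... | nothing = θ y

  mkSubst : ∀ {n} → Vec Var n → Vec Term n → Subst
  mkSubst []       []       y = var y
  mkSubst (x ∷ xs) (t ∷ ts) y = if x ≡ᵇ y then t else mkSubst xs ts y

  record Clause : Set where
    constructor clause
    field
      {arity} : ℕ
      pred    : DP arity
      args    : Vec Term arity
      body    : List Atom

  headPred : Clause → Σ ℕ DP
  headPred cl = Clause.arity cl , Clause.pred cl

  Program : Set₁
  Program = Clause → Set

  data _⊢_⇐_ (P : Program) : Atom → List Constraint → Set where
    DA : ∀ {Π n} {p : DP n} {ts : Vec Term n} {Bs : List Atom}
         (t' : Vec Term n) (θ : Subst) →
         P (clause p ts Bs) →
         (∀ (i : Fin n) → P ⊢ constr (lookup t' i == sub θ (lookup ts i)) ⇐ Π) →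
         (∀ B → B ∈ Bs → P ⊢ subAtom θ B ⇐ Π) →
         P ⊢ def p t' ⇐ Π
    EA : ∀ {Π t s} → Π ⊨ atomic (t == s) → P ⊢ constr (t == s) ⇐ Π
    PA : ∀ {Π n} {r : PP n} {ts : Vec Term n} →
         Π ⊨ atomic (prim r ts) → P ⊢ constr (prim r ts) ⇐ Π

-- Everything rests on the substitution lemma for existential constraints: η solves (∃Ys.Bs)θ
-- iff some valuation agreeing with eval η ∘ θ on the free variables satisfies Bs, because subC
-- renames the bound variables apart from θ so their values can be chosen freely.
-- A derivation of p(ts) ⇐ Π must end with DA on the only clause for p, at some instance θ; its
-- premises say every solution η of Π equates ts with θ(Xs) and satisfies the body under θ, which
-- is the right-hand side of the lemma. Conversely, one solution η₀ of Π (satisfiability) gives,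
-- through π(ts), values μ for the bound variables; for ground ts the instance Xs ↦ ts, Ys ↦ μ
-- makes every premise of DA a ground true constraint, hence entailed by any Π.
module Submission where

open import Defs
open import Data.Nat using (ℕ; zero; suc; _+_; _∸_; _⊔_; _≤_; _<_; _≤?_; _≡ᵇ_; s≤s; z≤n)
open import Data.Nat.Properties
  using (_≟_; m+[n∸m]≡n; m+n∸m≡n; m≤m+n; ≤-trans; m≤m⊔n; m≤n⊔m; ≡ᵇ⇒≡; ≡⇒≡ᵇ; <⇒≱)
open import Data.Bool using (true; false)
open import Data.Maybe using (Maybe; just; nothing)
open import Data.List using (List; []; _∷_; map; foldr; concatMap; length; upTo)
open import Data.List.Relation.Unary.All using (All; []; _∷_)
import Data.List.Relation.Unary.All as All
import Data.List.Relation.Unary.All.Properties as All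
open import Data.List.Relation.Unary.Any using (here; there)
import Data.List.Relation.Unary.Any as Any
open import Data.List.Membership.Propositional using (_∈_; _∉_)
open import Data.List.Membership.Propositional.Properties
  using (∈-++⁺ˡ; ∈-++⁺ʳ; ∈-map⁺; ∈-map⁻; ∈-upTo⁺; ∈-filter⁺; ∈-concatMap⁺)
open import Data.List.Membership.DecPropositional _≟_ using (_∈?_)
open import Data.List.Relation.Unary.Unique.Propositional using (Unique)
open import Data.List.Relation.Unary.AllPairs using (_∷_)
open import Data.Vec using (Vec; []; _∷_; lookup; toList)
import Data.Vec
open import Data.Vec.Properties using (lookup-map)
open import Data.Vec.Membership.Propositional.Properties using (∈-lookup; ∈-toList⁺)
open import Data.Fin using (zero; suc)
open import Data.Product using (∃-syntax; _×_; _,_)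
open import Data.Sum using (_⊎_; inj₁; inj₂)
open import Function using (id; _∘_)
open import Relation.Nullary using (yes; no; ¬?; contradiction)
open import Relation.Binary.PropositionalEquality

nth : {A : Set} → List A → ℕ → Maybe A
nth []       _       = nothing
nth (y ∷ ys) zero    = just y
nth (y ∷ ys) (suc i) = nth ys i

nth-∈ : ∀ {A : Set} (ys : List A) i {y} → nth ys i ≡ just y → y ∈ ys
nth-∈ (z ∷ ys) zero    refl = here refl
nth-∈ (z ∷ ys) (suc i) e    = there (nth-∈ ys i e)

nth-< : ∀ {A : Set} (ys : List A) i {y} → nth ys i ≡ just y → i < length ys
nth-< (z ∷ ys) zero    e = s≤s z≤n
nth-< (z ∷ ys) (suc i) e = s≤s (nth-< ys i e)

≤-foldr-⊔ : ∀ {A : Set} (f : A → ℕ) {xs x} → x ∈ xs → f x ≤ foldr (λ y m → f y ⊔ m) 0 xs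
≤-foldr-⊔ f {y ∷ xs} (here refl) = m≤m⊔n (f y) _
≤-foldr-⊔ f {y ∷ xs} (there x∈)  = ≤-trans (≤-foldr-⊔ f x∈) (m≤n⊔m (f y) _)

∉-shifted-upTo : ∀ {N z} k → z < N → z ∉ map (N +_) (upTo k)
∉-shifted-upTo {N} k z<N z∈ with ∈-map⁻ (N +_) z∈
... | i , _ , refl = <⇒≱ z<N (m≤m+n N i)

module _ (Sig : Signature) (𝒞 : Domain Sig) where
  open CLP Sig 𝒞

  indexOf-just : ∀ y Ys {i} → indexOf y Ys ≡ just i → nth Ys i ≡ just y
  indexOf-just y (z ∷ zs) e with y ≟ z
  indexOf-just y (.y ∷ zs) refl | yes refl = refl
  ... | no _ with indexOf y zs in e′
  indexOf-just y (z ∷ zs) refl | no _ | just j = indexOf-just y zs e′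

  indexOf-nothing : ∀ y Ys → indexOf y Ys ≡ nothing → y ∉ Ys
  indexOf-nothing y (z ∷ zs) e y∈ with y ≟ z
  ... | no y≢z with indexOf y zs in e′
  indexOf-nothing y (z ∷ zs) e (here y≡z) | no y≢z | nothing = y≢z y≡z
  indexOf-nothing y (z ∷ zs) e (there y∈) | no y≢z | nothing = indexOf-nothing y zs e′ y∈

  mkSubst-head : ∀ {n} x (Xs : Vec Var n) t ts → mkSubst (x ∷ Xs) (t ∷ ts) x ≡ t
  mkSubst-head x Xs t ts with x ≡ᵇ x | ≡⇒≡ᵇ x x refl
  ... | true | _ = refl

  mkSubst-tail : ∀ {n} {x y} (Xs : Vec Var n) t ts → x ≢ y →
                 mkSubst (x ∷ Xs) (t ∷ ts) y ≡ mkSubst Xs ts y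
  mkSubst-tail {x = x} {y} Xs t ts x≢y with x ≡ᵇ y | ≡ᵇ⇒≡ x y
  ... | true  | x≡y = contradiction (x≡y _) x≢y
  ... | false | _   = refl

  mkSubst-lookup : ∀ {n} (Xs : Vec Var n) ts → Unique (toList Xs) → ∀ i →
                   mkSubst Xs ts (lookup Xs i) ≡ lookup ts i
  mkSubst-lookup (x ∷ Xs) (t ∷ ts) _ zero = mkSubst-head x Xs t ts
  mkSubst-lookup (x ∷ Xs) (t ∷ ts) (x∉ ∷ u) (suc i) =
    trans (mkSubst-tail Xs t ts (All.lookup x∉ (∈-toList⁺ (∈-lookup i Xs))))
          (mkSubst-lookup Xs ts u i)

  mkSubst-∈ : ∀ {n} (Xs : Vec Var n) ts {x} → x ∈ toList Xs →
              ∃[ j ] lookup Xs j ≡ x × mkSubst Xs ts x ≡ lookup ts j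
  mkSubst-∈ (y ∷ Xs) (t ∷ ts) {x} x∈ with y ≟ x | x∈
  ... | yes refl | _ = zero , refl , mkSubst-head y Xs t ts
  ... | no y≢x | here x≡y = contradiction (sym x≡y) y≢x
  ... | no y≢x | there x∈′ with mkSubst-∈ Xs ts x∈′
  ...   | j , Xs[j]≡x , θx≡ts[j] = suc j , Xs[j]≡x , trans (mkSubst-tail Xs t ts y≢x) θx≡ts[j]

  mutual
    eval-sub : ∀ η θ t → eval η (sub θ t) ≡ eval (eval η ∘ θ) t
    eval-sub η θ (var x)    = refl
    eval-sub η θ (val b)    = refl
    eval-sub η θ (con c ts) = cong (gcon c) (evals-sub η θ ts)

    evals-sub : ∀ {n} η θ (ts : Vec Term n) → evals η (subs θ ts) ≡ evals (eval η ∘ θ) ts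
    evals-sub η θ []       = refl
    evals-sub η θ (t ∷ ts) = cong₂ _∷_ (eval-sub η θ t) (evals-sub η θ ts)

  mutual
    eval-cong : ∀ μ μ′ t → (∀ x → x ∈ vars t → μ x ≡ μ′ x) → eval μ t ≡ eval μ′ t
    eval-cong μ μ′ (var x)    μ≈ = μ≈ x (here refl)
    eval-cong μ μ′ (val b)    μ≈ = refl
    eval-cong μ μ′ (con c ts) μ≈ = cong (gcon c) (evals-cong μ μ′ ts μ≈)

    evals-cong : ∀ {n} μ μ′ (ts : Vec Term n) → (∀ x → x ∈ varss ts → μ x ≡ μ′ x) →
                 evals μ ts ≡ evals μ′ ts
    evals-cong μ μ′ []       μ≈ = refl
    evals-cong μ μ′ (t ∷ ts) μ≈ =
      cong₂ _∷_ (eval-cong μ μ′ t (λ x → μ≈ x ∘ ∈-++⁺ˡ))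
                (evals-cong μ μ′ ts (λ x → μ≈ x ∘ ∈-++⁺ʳ (vars t)))

  eval-ground : ∀ μ μ′ t → Ground t → eval μ t ≡ eval μ′ t
  eval-ground μ μ′ t g = eval-cong μ μ′ t (λ x x∈ → contradiction (subst (x ∈_) g x∈) λ ())

  holdsA-subA : ∀ η θ B → holdsA η (subA θ B) ≡ holdsA (eval η ∘ θ) B
  holdsA-subA η θ (prim r ts) = cong (interp r) (evals-sub η θ ts)
  holdsA-subA η θ (t == s)    = cong₂ _≡_ (eval-sub η θ t) (eval-sub η θ s)

  holdsA-cong : ∀ μ μ′ B → (∀ x → x ∈ varsA B → μ x ≡ μ′ x) → holdsA μ B ≡ holdsA μ′ B
  holdsA-cong μ μ′ (prim r ts) μ≈ = cong (interp r) (evals-cong μ μ′ ts μ≈)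
  holdsA-cong μ μ′ (t == s)    μ≈ =
    cong₂ _≡_ (eval-cong μ μ′ t (λ x → μ≈ x ∘ ∈-++⁺ˡ))
              (eval-cong μ μ′ s (λ x → μ≈ x ∘ ∈-++⁺ʳ (vars t)))

  holdsA-subA⁺ : ∀ η θ μ B → (∀ x → x ∈ varsA B → eval η (θ x) ≡ μ x) →
                 holdsA μ B → holdsA η (subA θ B)
  holdsA-subA⁺ η θ μ B θ≈μ =
      subst id (sym (holdsA-subA η θ B))
    ∘ subst id (holdsA-cong μ (eval η ∘ θ) B (λ x → sym ∘ θ≈μ x))

  mutual
    reify : Val → Term
    reify (gval b)    = val b
    reify (gcon c vs) = con c (reifys vs)

    reifys : ∀ {n} → Vec Val n → Vec Term n
    reifys []       = []
    reifys (v ∷ vs) = reify v ∷ reifys vs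

  mutual
    eval-reify : ∀ η v → eval η (reify v) ≡ v
    eval-reify η (gval b)    = refl
    eval-reify η (gcon c vs) = cong (gcon c) (evals-reifys η vs)

    evals-reifys : ∀ {n} η (vs : Vec Val n) → evals η (reifys vs) ≡ vs
    evals-reifys η []       = refl
    evals-reifys η (v ∷ vs) = cong₂ _∷_ (eval-reify η v) (evals-reifys η vs)

  override : List Var → (Var → Val) → Subst → Subst
  override Ys μ θ x with x ∈? Ys
  ... | yes _ = reify (μ x)
  ... | no _  = θ x

  override-∉ : ∀ {Ys μ θ x} → x ∉ Ys → override Ys μ θ x ≡ θ x
  override-∉ {Ys} {x = x} x∉ with x ∈? Ys
  ... | yes x∈ = contradiction x∈ x∉
  ... | no _   = refl

  Sol-atomic⁺ : ∀ {η} κ → holdsA η κ → Sol η (atomic κ)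
  Sol-atomic⁺ {η} κ h = η , (λ _ _ → refl) , h ∷ []

  Sol-atomic⁻ : ∀ {η} κ → Sol η (atomic κ) → holdsA η κ
  Sol-atomic⁻ {η} κ (ρ , ρ≈η , h ∷ []) = subst id (holdsA-cong ρ η κ (λ x _ → ρ≈η x λ ())) h

  ⊢constr⁺ : ∀ {P Π} κ → Π ⊨ atomic κ → P ⊢ constr κ ⇐ Π
  ⊢constr⁺ (prim r ts) = PA
  ⊢constr⁺ (t == s)    = EA

  ⊢constr⁻ : ∀ {P Π κ} → P ⊢ constr κ ⇐ Π → Π ⊨ atomic κ
  ⊢constr⁻ (EA Π⊨κ) = Π⊨κ
  ⊢constr⁻ (PA Π⊨κ) = Π⊨κ

  ⊢constr-sound : ∀ {P Π κ} → P ⊢ constr κ ⇐ Π → ∀ η → Sols η Π → holdsA η κ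
  ⊢constr-sound {κ = κ} ⊢κ η η⊨Π = Sol-atomic⁻ κ (⊢constr⁻ ⊢κ η η⊨Π)

  ⊢constr-valid : ∀ {P Π} κ → (∀ η → holdsA η κ) → P ⊢ constr κ ⇐ Π
  ⊢constr-valid κ ⊨κ = ⊢constr⁺ κ λ η _ → Sol-atomic⁺ κ (⊨κ η)

  ∈-concatMap-varsA : ∀ {x B Bs} → B ∈ Bs → x ∈ varsA B → x ∈ concatMap varsA Bs
  ∈-concatMap-varsA B∈ x∈ = ∈-concatMap⁺ varsA (Any.map (λ { refl → x∈ }) B∈)

  bindFresh : ℕ → List Var → (Var → Val) → Valuation → Valuation
  bindFresh N Ys μ η z with N ≤? z
  ... | no _ = η z
  ... | yes _ with nth Ys (z ∸ N)
  ...   | just y  = μ y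
  ...   | nothing = η z

  bindFresh-fresh : ∀ N Ys μ η {i y} → nth Ys i ≡ just y → bindFresh N Ys μ η (N + i) ≡ μ y
  bindFresh-fresh N Ys μ η {i} e with N ≤? N + i
  ... | no N≰N+i = contradiction (m≤m+n N i) N≰N+i
  ... | yes _ rewrite m+n∸m≡n N i | e = refl

  bindFresh-other : ∀ N Ys μ η z → z ∉ map (N +_) (upTo (length Ys)) →
                    bindFresh N Ys μ η z ≡ η z
  bindFresh-other N Ys μ η z z∉ with N ≤? z
  ... | no _ = refl
  ... | yes N≤z with nth Ys (z ∸ N) in e
  ...   | nothing = refl
  ...   | just y  = contradiction (subst (_∈ map (N +_) (upTo (length Ys))) (m+[n∸m]≡n N≤z) z∈) z∉
    where z∈ = ∈-map⁺ (N +_) (∈-upTo⁺ (nth-< Ys _ e))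

  -- Recovers, by unification against shape, the fresh offset N and the renaming σ
  -- that subC binds in a where block.
  record Renaming (θ : Subst) (Ys : List Var) (Bs : List AConstr) : Set where
    field
      N     : ℕ
      σ     : Subst
      shape : subC θ (exC Ys Bs) ≡ exC (map (N +_) (upTo (length Ys))) (map (subA σ) Bs)

  subC-renaming : ∀ θ Ys Bs → Renaming θ Ys Bs
  subC-renaming θ Ys Bs = record { shape = refl }

  AgreeOnFree : List Var → List AConstr → (Var → Val) → (Var → Val) → Set
  AgreeOnFree Ys Bs μ μ′ = ∀ x → x ∈ concatMap varsA Bs → x ∉ Ys → μ x ≡ μ′ x

  module _ (θ : Subst) (Ys : List Var) (Bs : List AConstr) where
    open Renaming (subC-renaming θ Ys Bs) using (N; σ)

    σ-bound : ∀ {x} → x ∈ Ys → ∃[ i ] σ x ≡ var (N + i) × nth Ys i ≡ just x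
    σ-bound {x} x∈ with indexOf x Ys in e
    ... | just i  = i , refl , indexOf-just x Ys e
    ... | nothing = contradiction x∈ (indexOf-nothing x Ys e)

    σ-free : ∀ {x} → x ∉ Ys → σ x ≡ θ x
    σ-free {x} x∉ with indexOf x Ys in e
    ... | just i  = contradiction (nth-∈ Ys i (indexOf-just x Ys e)) x∉
    ... | nothing = refl

    <N : ∀ {x z} → x ∈ concatMap varsA Bs → x ∉ Ys → z ∈ vars (θ x) → z < N
    <N {x} x∈ x∉ z∈ =
      s≤s (≤-trans (≤-foldr-⊔ id z∈)
                   (≤-foldr-⊔ (maxVar ∘ θ) (∈-filter⁺ (λ y → ¬? (y ∈? Ys)) x∈ x∉)))

    eval-θ-off-fresh : ∀ ρ η → (∀ z → z ∉ map (N +_) (upTo (length Ys)) → ρ z ≡ η z) →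
                       AgreeOnFree Ys Bs (eval ρ ∘ θ) (eval η ∘ θ)
    eval-θ-off-fresh ρ η ρ≈η x x∈ x∉ =
      eval-cong ρ η (θ x) (λ z z∈ → ρ≈η z (∉-shifted-upTo (length Ys) (<N x∈ x∉ z∈)))

    Sol-subC⁺ : ∀ η μ → AgreeOnFree Ys Bs μ (eval η ∘ θ) → All (holdsA μ) Bs →
                Sol η (subC θ (exC Ys Bs))
    Sol-subC⁺ η μ μ≈ μ⊨Bs = ρ , bindFresh-other N Ys μ η , All.map⁺ (All.tabulate holds)
      where
      ρ = bindFresh N Ys μ η

      ρ∘σ≈μ : ∀ x → x ∈ concatMap varsA Bs → eval ρ (σ x) ≡ μ x
      ρ∘σ≈μ x x∈ with x ∈? Ys
      ... | yes x∈Ys with σ-bound x∈Ys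
      ...   | i , σx≡ , Ys[i]≡x rewrite σx≡ = bindFresh-fresh N Ys μ η Ys[i]≡x
      ρ∘σ≈μ x x∈ | no x∉Ys = begin
        eval ρ (σ x)  ≡⟨ cong (eval ρ) (σ-free x∉Ys) ⟩
        eval ρ (θ x)  ≡⟨ eval-θ-off-fresh ρ η (bindFresh-other N Ys μ η) x x∈ x∉Ys ⟩
        eval η (θ x)  ≡⟨ sym (μ≈ x x∈ x∉Ys) ⟩
        μ x           ∎
        where open ≡-Reasoning

      holds : ∀ {B} → B ∈ Bs → holdsA ρ (subA σ B)
      holds {B} B∈ =
        holdsA-subA⁺ ρ σ μ B (λ x → ρ∘σ≈μ x ∘ ∈-concatMap-varsA B∈) (All.lookup μ⊨Bs B∈)

    Sol-subC⁻ : ∀ η → Sol η (subC θ (exC Ys Bs)) →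
                ∃[ μ ] AgreeOnFree Ys Bs μ (eval η ∘ θ) × All (holdsA μ) Bs
    Sol-subC⁻ η (ρ , ρ≈η , ρ⊨Bsσ) =
        eval ρ ∘ σ
      , (λ x x∈ x∉ → trans (cong (eval ρ) (σ-free x∉)) (eval-θ-off-fresh ρ η ρ≈η x x∈ x∉))
      , All.map (λ {B} → subst id (holdsA-subA ρ σ B)) (All.map⁻ ρ⊨Bsσ)

  module _ {n} (p : DP n) (Xs : Vec Var n) (Ys : List Var) (Bs : List AConstr) (P : Program)
           (vars⊆Xs∪Ys : ∀ x → x ∈ concatMap varsA Bs → x ∈ toList Xs ⊎ x ∈ Ys)
           (ts : Vec Term n) (Π : List Constraint) where

    private
      θX : Subst
      θX = mkSubst Xs ts

      pClause : Clause
      pClause = clause p (Data.Vec.map var Xs) (map constr Bs)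

    free∈Xs : ∀ {x} → x ∈ concatMap varsA Bs → x ∉ Ys →
              ∃[ j ] lookup Xs j ≡ x × θX x ≡ lookup ts j
    free∈Xs {x} x∈ x∉ with vars⊆Xs∪Ys x x∈
    ... | inj₁ x∈Xs = mkSubst-∈ Xs ts x∈Xs
    ... | inj₂ x∈Ys = contradiction x∈Ys x∉

    soundness : (∀ cl → P cl → headPred cl ≡ (n , p) → cl ≡ pClause) →
                P ⊢ def p ts ⇐ Π → Π ⊨ subC θX (exC Ys Bs)
    soundness only-pClause (DA _ θ P∋cl args body) with only-pClause _ P∋cl refl
    ... | refl = λ η η⊨Π → Sol-subC⁺ θX Ys Bs η (eval η ∘ θ) (θ≈θX η η⊨Π) (body-holds η η⊨Π)
      where
      args-hold : ∀ η → Sols η Π → ∀ j → eval η (lookup ts j) ≡ eval η (θ (lookup Xs j))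
      args-hold η η⊨Π j = trans (⊢constr-sound (args j) η η⊨Π)
                                (cong (eval η ∘ sub θ) (lookup-map j var Xs))

      θ≈θX : ∀ η → Sols η Π → AgreeOnFree Ys Bs (eval η ∘ θ) (eval η ∘ θX)
      θ≈θX η η⊨Π x x∈ x∉ with free∈Xs x∈ x∉
      ... | j , refl , θXx≡ts[j] rewrite θXx≡ts[j] = sym (args-hold η η⊨Π j)

      body-holds : ∀ η → Sols η Π → All (holdsA (eval η ∘ θ)) Bs
      body-holds η η⊨Π = All.tabulate λ {B} B∈ →
        subst id (holdsA-subA η θ B) (⊢constr-sound (body (constr B) (∈-map⁺ constr B∈)) η η⊨Π)

    completeness : Unique (toList Xs) → (∀ y → y ∈ Ys → y ∉ toList Xs) → P pClause →
                   Satisfiable Π → All Ground (toList ts) →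
                   Π ⊨ subC θX (exC Ys Bs) → P ⊢ def p ts ⇐ Π
    completeness Xs-unique Ys∩Xs≡∅ P∋pClause (η₀ , η₀⊨Π) ts-ground ⊨π
      with Sol-subC⁻ θX Ys Bs η₀ (⊨π η₀ η₀⊨Π)
    ... | μ , μ≈ , μ⊨Bs = DA ts θ′ P∋pClause args body
      where
      θ′ : Subst
      θ′ = override Ys μ θX

      θ′-args : ∀ i → sub θ′ (lookup (Data.Vec.map var Xs) i) ≡ lookup ts i
      θ′-args i rewrite lookup-map i var Xs = begin
        override Ys μ θX (lookup Xs i)  ≡⟨ override-∉ Xs[i]∉Ys ⟩
        θX (lookup Xs i)                ≡⟨ mkSubst-lookup Xs ts Xs-unique i ⟩
        lookup ts i                     ∎
        where
        open ≡-Reasoning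
        Xs[i]∉Ys : lookup Xs i ∉ Ys
        Xs[i]∉Ys Xs[i]∈Ys = Ys∩Xs≡∅ _ Xs[i]∈Ys (∈-toList⁺ (∈-lookup i Xs))

      θ′≈μ : ∀ η x → x ∈ concatMap varsA Bs → eval η (θ′ x) ≡ μ x
      θ′≈μ η x x∈ with x ∈? Ys
      ... | yes _ = eval-reify η (μ x)
      ... | no x∉Ys with free∈Xs x∈ x∉Ys
      ...   | j , refl , θXx≡ts[j] = begin
        eval η (θX x)           ≡⟨ cong (eval η) θXx≡ts[j] ⟩
        eval η (lookup ts j)    ≡⟨ eval-ground η η₀ (lookup ts j) ts[j]-ground ⟩
        eval η₀ (lookup ts j)   ≡⟨ cong (eval η₀) (sym θXx≡ts[j]) ⟩
        eval η₀ (θX x)          ≡⟨ sym (μ≈ x x∈ x∉Ys) ⟩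
        μ x                     ∎
        where
        open ≡-Reasoning
        ts[j]-ground = All.lookup ts-ground (∈-toList⁺ (∈-lookup j ts))

      args : ∀ i → P ⊢ constr (lookup ts i == sub θ′ (lookup (Data.Vec.map var Xs) i)) ⇐ Π
      args i = ⊢constr-valid _ λ η → cong (eval η) (sym (θ′-args i))

      body : ∀ B → B ∈ map constr Bs → P ⊢ subAtom θ′ B ⇐ Π
      body B B∈ with ∈-map⁻ constr B∈
      ... | B₀ , B₀∈ , refl = ⊢constr-valid _ λ η →
        holdsA-subA⁺ η θ′ μ B₀ (λ x → θ′≈μ η x ∘ ∈-concatMap-varsA B₀∈) (All.lookup μ⊨Bs B₀∈)

lemma3p1 : (Sig : Signature) (𝒞 : Domain Sig) → let open CLP Sig 𝒞 in
    ∀ {n} (p : DP n) (Xs : Vec Var n) (Ys : List Var) (Bs : List AConstr) (P : Program) →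
    Unique (toList Xs) →
    (∀ y → y ∈ Ys → y ∉ toList Xs) →
    (∀ x → x ∈ concatMap varsA Bs → x ∈ toList Xs ⊎ x ∈ Ys) →
    P (clause p (Data.Vec.map var Xs) (map constr Bs)) →
    (∀ cl → P cl → headPred cl ≡ (n , p) → cl ≡ clause p (Data.Vec.map var Xs) (map constr Bs)) →
    ∀ (ts : Vec Term n) (Π : List Constraint) → Satisfiable Π →
      ((P ⊢ def p ts ⇐ Π → Π ⊨ subC (mkSubst Xs ts) (exC Ys Bs))
      × (All Ground (toList ts) → Π ⊨ subC (mkSubst Xs ts) (exC Ys Bs) → P ⊢ def p ts ⇐ Π))
lemma3p1 Sig 𝒞 p Xs Ys Bs P Xs-unique Ys∩Xs≡∅ vars⊆Xs∪Ys P∋pClause only-pClause ts Π sat =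
    soundness Sig 𝒞 p Xs Ys Bs P vars⊆Xs∪Ys ts Π only-pClause
  , completeness Sig 𝒞 p Xs Ys Bs P vars⊆Xs∪Ys ts Π Xs-unique Ys∩Xs≡∅ P∋pClause sat
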